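{- Let $n \geq 2$ be an integer, let $N := n - \frac{1}{24}$, and let $k$ be a positive integer with $k \leq \frac{\sqrt{N}}{4}$. Then \[ \nu_k(n) - \nu_k(n-k) > 0. \]
   Context: For a positive integer $k$ and nonnegative integer $m$, $\nu_k(m)$ denotes the number of partitions of $m$ having no part equal to $k$ (non-$k$-ary partitions); equivalently $\nu_k(m) = p(m) - p(m-k)$, where $p$ is the partition function and $p(r)=0$ for $r<0$, $p(0)=1$. -}

module Defs where

open import Data.Nat using (ℕ; zero; suc; _+_; _*_; _∸_; _≤ᵇ_; _≡ᵇ_)
open import Data.Bool using (Bool; true; false; if_then_else_)

-- Counting partitions by the multiplicity of each part size.
-- bounded k m j = number of partitions of m all of whose parts lie in
-- {1, …, j} and none of whose parts equals k.
-- (k = 0 imposes no restriction, since parts are positive.)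
-- A partition with parts ≤ suc j is determined by the multiplicity t of the
-- part (suc j) (with t * suc j ≤ m) and a partition of m ∸ t * suc j with
-- parts ≤ j; if suc j = k only t = 0 is allowed.

sumMult : (ℕ → ℕ) → ℕ → ℕ → ℕ → ℕ
sumMult f s m zero    = f m
sumMult f s m (suc c) =
  sumMult f s m c + (if (suc c * s) ≤ᵇ m then f (m ∸ suc c * s) else 0)

bounded : ℕ → ℕ → ℕ → ℕ
bounded k m zero    = if m ≡ᵇ 0 then 1 else 0
bounded k m (suc j) =
  if suc j ≡ᵇ k then bounded k m j
  else sumMult (λ r → bounded k r j) (suc j) m m

ν : ℕ → ℕ → ℕ
ν k m = bounded k m m

p : ℕ → ℕ
p m = ν 0 m

module Submission where

open import Defs
open import Data.Nat using (ℕ; _+_; _*_; _∸_; _≤_; _<_)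
open import Data.Nat.Base
  using (zero; suc; z≤n; s≤s; _≤ᵇ_; _≡ᵇ_; _≤′_; ≤′-refl; ≤′-step; NonZero)
open import Data.Nat.Properties
open import Data.Bool using (true; false; if_then_else_)
open import Data.Product using (_,_)
open import Data.Sum using (inj₁; inj₂)
open import Function using (_∘_)
open import Relation.Nullary using (yes; no; contradiction)
open import Relation.Binary.PropositionalEquality
open import Algebra.Properties.CommutativeSemigroup +-commutativeSemigroup
  using (xy∙z≈xz∙y)

-- For k ≠ 1, adding k parts 1 to a partition of n − k gives a partition of n
-- with parts < n; none of these is the one-part partition (n), so
-- ν k (n − k) < ν k n.
--
-- For k = 1 write B_J(m) = bounded 1 m J for the number of partitions of m
-- into parts from {2, …, J}. The recurrence B_{J+1}(m) = B_J(m) + B_{J+1}(m − J − 1) and the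
-- monotonicity of B_J in J show that the increment B_{J+1}(m + 1) − B_J(m)
-- is nondecreasing in J. At J = m it is ν₁(m + 1) − ν₁(m), and at J = 2 it is
-- B_3(m + 1) − B_2(m) > 0 for m ≥ 8, because B_2(m) ≤ 1 and B_3(m + 1) ≥ 2.

if-≤ᵇ-yes : ∀ {A : Set} {a b} {x y : A} → a ≤ b → (if a ≤ᵇ b then x else y) ≡ x
if-≤ᵇ-yes {a = a} {b} a≤b with a ≤ᵇ b | ≤⇒≤ᵇ a≤b
... | true | _ = refl

if-≤ᵇ-no : ∀ {A : Set} {a b} {x y : A} → b < a → (if a ≤ᵇ b then x else y) ≡ y
if-≤ᵇ-no {a = a} {b} b<a with a ≤ᵇ b | ≤ᵇ⇒≤ a b
... | false | _    = refl
... | true  | a≤b = contradiction (a≤b _) (<⇒≱ b<a)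

sumMult-head≤ : ∀ f s m c → f m ≤ sumMult f s m c
sumMult-head≤ f s m zero    = ≤-refl
sumMult-head≤ f s m (suc c) = ≤-trans (sumMult-head≤ f s m c) (m≤m+n _ _)

sumMult-≤-suc : ∀ f s m c → sumMult f s m c ≤ sumMult f s m (suc c)
sumMult-≤-suc f s m c = m≤m+n _ _

sumMult-small : ∀ f s m c → m < s → sumMult f s m c ≡ f m
sumMult-small f s m zero    m<s = refl
sumMult-small f s m (suc c) m<s = begin
  sumMult f s m c + (if suc c * s ≤ᵇ m then _ else 0)
    ≡⟨ cong₂ _+_ (sumMult-small f s m c m<s)
                 (if-≤ᵇ-no (≤-trans m<s (m≤n*m s (suc c)))) ⟩
  f m + 0
    ≡⟨ +-identityʳ (f m) ⟩
  f m ∎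
  where open ≡-Reasoning

sumMult-saturated : ∀ f s .{{_ : NonZero s}} m c → m ≤ c →
  sumMult f s m c ≡ sumMult f s m m
sumMult-saturated f s m zero    z≤n   = refl
sumMult-saturated f s m (suc c) m≤1+c with m≤n⇒m<n∨m≡n m≤1+c
... | inj₂ refl  = refl
... | inj₁ m<1+c = begin
  sumMult f s m c + (if suc c * s ≤ᵇ m then _ else 0)
    ≡⟨ cong (sumMult f s m c +_) (if-≤ᵇ-no (≤-trans m<1+c (m≤m*n (suc c) s))) ⟩
  sumMult f s m c + 0
    ≡⟨ +-identityʳ _ ⟩
  sumMult f s m c
    ≡⟨ sumMult-saturated f s m c (≤-pred m<1+c) ⟩
  sumMult f s m m ∎
  where open ≡-Reasoning

summand-shift : ∀ (f : ℕ → ℕ) s m t →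
  (if s + t * s ≤ᵇ s + m then f (s + m ∸ (s + t * s)) else 0) ≡
  (if t * s ≤ᵇ m then f (m ∸ t * s) else 0)
summand-shift f s m t with t * s ≤? m
... | yes ts≤m = trans (if-≤ᵇ-yes (+-monoʳ-≤ s ts≤m))
                 (trans (cong f ([m+n]∸[m+o]≡n∸o s m (t * s)))
                        (sym (if-≤ᵇ-yes ts≤m)))
... | no  ts≰m = trans (if-≤ᵇ-no (+-monoʳ-< s (≰⇒> ts≰m)))
                       (sym (if-≤ᵇ-no (≰⇒> ts≰m)))

-- Splitting off the multiplicity-0 term shifts every other term down by one s.
sumMult-shift : ∀ f s m c →
  sumMult f s (s + m) (suc c) ≡ f (s + m) + sumMult f s m c
sumMult-shift f s m zero    = cong (f (s + m) +_) (summand-shift f s m 0)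
sumMult-shift f s m (suc c) = begin
  sumMult f s (s + m) (suc c) + _
    ≡⟨ cong₂ _+_ (sumMult-shift f s m c) (summand-shift f s m (suc c)) ⟩
  (f (s + m) + sumMult f s m c) + _
    ≡⟨ +-assoc (f (s + m)) (sumMult f s m c) _ ⟩
  f (s + m) + sumMult f s m (suc c) ∎
  where open ≡-Reasoning

sumMult-mono : ∀ f s → (∀ r → f r ≤ f (suc r)) →
  ∀ m c → sumMult f s m c ≤ sumMult f s (suc m) c
sumMult-mono f s f-mono m zero    = f-mono m
sumMult-mono f s f-mono m (suc c) =
  +-mono-≤ (sumMult-mono f s f-mono m c) summand-mono
  where
  summand-mono : (if suc c * s ≤ᵇ m then f (m ∸ suc c * s) else 0) ≤
                 (if suc c * s ≤ᵇ suc m then f (suc m ∸ suc c * s) else 0)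
  summand-mono with suc c * s ≤? m
  ... | yes cs≤m = begin
    (if suc c * s ≤ᵇ m then f (m ∸ suc c * s) else 0)
      ≡⟨ if-≤ᵇ-yes cs≤m ⟩
    f (m ∸ suc c * s)
      ≤⟨ f-mono _ ⟩
    f (suc (m ∸ suc c * s))
      ≡⟨ cong f (+-∸-assoc 1 cs≤m) ⟨
    f (suc m ∸ suc c * s)
      ≡⟨ if-≤ᵇ-yes (m≤n⇒m≤1+n cs≤m) ⟨
    (if suc c * s ≤ᵇ suc m then f (suc m ∸ suc c * s) else 0) ∎
    where open ≤-Reasoning
  ... | no cs≰m = ≤-trans (≤-reflexive (if-≤ᵇ-no (≰⇒> cs≰m))) z≤n

bounded-excluded : ∀ k m j → suc j ≡ k → bounded k m (suc j) ≡ bounded k m j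
bounded-excluded k m j 1+j≡k with suc j ≡ᵇ k | ≡⇒≡ᵇ (suc j) k 1+j≡k
... | true | _ = refl

bounded-allowed : ∀ k m j → suc j ≢ k →
  bounded k m (suc j) ≡ sumMult (λ r → bounded k r j) (suc j) m m
bounded-allowed k m j 1+j≢k with suc j ≡ᵇ k | ≡ᵇ⇒≡ (suc j) k
... | false | _      = refl
... | true  | 1+j≡k = contradiction (1+j≡k _) 1+j≢k

bounded-mono-parts : ∀ k m j → bounded k m j ≤ bounded k m (suc j)
bounded-mono-parts k m j with suc j ≟ k
... | yes 1+j≡k = ≤-reflexive (sym (bounded-excluded k m j 1+j≡k))
... | no  1+j≢k = ≤-trans (sumMult-head≤ _ (suc j) m m)
                          (≤-reflexive (sym (bounded-allowed k m j 1+j≢k)))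

bounded-suc-stable : ∀ k m j → m ≤ j → bounded k m (suc j) ≡ bounded k m j
bounded-suc-stable k m j m≤j with suc j ≟ k
... | yes 1+j≡k = bounded-excluded k m j 1+j≡k
... | no  1+j≢k = trans (bounded-allowed k m j 1+j≢k)
                        (sumMult-small _ (suc j) m m (s≤s m≤j))

bounded-stable : ∀ k m j → m ≤ j → bounded k m j ≡ ν k m
bounded-stable k m zero    z≤n   = refl
bounded-stable k m (suc j) m≤1+j with m≤n⇒m<n∨m≡n m≤1+j
... | inj₂ refl  = refl
... | inj₁ m<1+j = trans (bounded-suc-stable k m j (≤-pred m<1+j))
                         (bounded-stable k m j (≤-pred m<1+j))

bounded-zero : ∀ k j → bounded k 0 j ≡ 1
bounded-zero k zero    = refl
bounded-zero k (suc j) = trans (bounded-suc-stable k 0 j z≤n) (bounded-zero k j)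

-- A partition using the allowed part j + 1 either avoids it or contains it.
bounded-recurrence : ∀ k m j → suc j ≢ k →
  bounded k (suc j + m) (suc j) ≡ bounded k (suc j + m) j + bounded k m (suc j)
bounded-recurrence k m j 1+j≢k = begin
  bounded k (suc j + m) (suc j)
    ≡⟨ bounded-allowed k (suc j + m) j 1+j≢k ⟩
  sumMult f (suc j) (suc j + m) (suc (j + m))
    ≡⟨ sumMult-shift f (suc j) m (j + m) ⟩
  f (suc j + m) + sumMult f (suc j) m (j + m)
    ≡⟨ cong (f (suc j + m) +_) (sumMult-saturated f (suc j) m (j + m) (m≤n+m m j)) ⟩
  f (suc j + m) + sumMult f (suc j) m m
    ≡⟨ cong (f (suc j + m) +_) (bounded-allowed k m j 1+j≢k) ⟨
  f (suc j + m) + bounded k m (suc j) ∎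
  where
  open ≡-Reasoning
  f : ℕ → ℕ
  f r = bounded k r j

ν-suc : ∀ k j → suc j ≢ k → ν k (suc j) ≡ bounded k (suc j) j + 1
ν-suc k j 1+j≢k =
  subst (λ n → bounded k n (suc j) ≡ bounded k n j + 1) (+-identityʳ (suc j))
        (trans (bounded-recurrence k 0 j 1+j≢k)
               (cong (bounded k (suc j + 0) j +_) (bounded-zero k (suc j))))

bounded-ones : ∀ k m → 1 ≢ k → bounded k m 1 ≡ 1
bounded-ones k zero    1≢k = bounded-zero k 1
bounded-ones k (suc m) 1≢k = trans (bounded-recurrence k m 0 1≢k) (bounded-ones k m 1≢k)

bounded-mono-suc : ∀ k j m → 1 ≢ k → bounded k m (suc j) ≤ bounded k (suc m) (suc j)
bounded-mono-suc k zero    m 1≢k =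
  ≤-reflexive (trans (bounded-ones k m 1≢k) (sym (bounded-ones k (suc m) 1≢k)))
bounded-mono-suc k (suc j) m 1≢k with suc (suc j) ≟ k
... | yes 2+j≡k = begin
  bounded k m (2 + j)       ≡⟨ bounded-excluded k m (suc j) 2+j≡k ⟩
  bounded k m (suc j)       ≤⟨ bounded-mono-suc k j m 1≢k ⟩
  bounded k (suc m) (suc j) ≡⟨ bounded-excluded k (suc m) (suc j) 2+j≡k ⟨
  bounded k (suc m) (2 + j) ∎
  where open ≤-Reasoning
... | no  2+j≢k = begin
  bounded k m (2 + j)
    ≡⟨ bounded-allowed k m (suc j) 2+j≢k ⟩
  sumMult f (2 + j) m m
    ≤⟨ sumMult-mono f (2 + j) (λ r → bounded-mono-suc k j r 1≢k) m m ⟩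
  sumMult f (2 + j) (suc m) m
    ≤⟨ sumMult-≤-suc f (2 + j) (suc m) m ⟩
  sumMult f (2 + j) (suc m) (suc m)
    ≡⟨ bounded-allowed k (suc m) (suc j) 2+j≢k ⟨
  bounded k (suc m) (2 + j) ∎
  where
  open ≤-Reasoning
  f : ℕ → ℕ
  f r = bounded k r (suc j)

bounded-mono : ∀ k j {m m′} → 1 ≢ k → m ≤ m′ →
  bounded k m (suc j) ≤ bounded k m′ (suc j)
bounded-mono k j {m} 1≢k m≤m′ = go (≤⇒≤′ m≤m′)
  where
  go : ∀ {n} → m ≤′ n → bounded k m (suc j) ≤ bounded k n (suc j)
  go ≤′-refl         = ≤-refl
  go (≤′-step m≤′n) = ≤-trans (go m≤′n) (bounded-mono-suc k j _ 1≢k)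

ν-drop-part : ∀ k n → 2 ≤ k → k < n → ν k (n ∸ k) < ν k n
ν-drop-part k n@(suc j@(suc i)) 2≤k k<n = begin-strict
  ν k (n ∸ k)         ≡⟨ bounded-stable k (n ∸ k) j n∸k≤j ⟨
  bounded k (n ∸ k) j ≤⟨ bounded-mono k i (<⇒≢ 2≤k) (m∸n≤m n k) ⟩
  bounded k n j       <⟨ m<m+n (bounded k n j) (s≤s z≤n) ⟩
  bounded k n j + 1   ≡⟨ ν-suc k j (<⇒≢ k<n ∘ sym) ⟨
  ν k n ∎
  where
  open ≤-Reasoning
  n∸k≤j : n ∸ k ≤ j
  n∸k≤j = ∸-monoʳ-≤ n (≤-trans (s≤s z≤n) 2≤k)
ν-drop-part (suc (suc _)) (suc zero) _ (s≤s ())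

rearrange-≤ : ∀ a b c d e f → a + c ≤ d + e → b ≤ f → (a + b) + c ≤ (d + f) + e
rearrange-≤ a b c d e f a+c≤d+e b≤f = begin
  (a + b) + c ≡⟨ xy∙z≈xz∙y a b c ⟩
  (a + c) + b ≤⟨ +-mono-≤ a+c≤d+e b≤f ⟩
  (d + e) + f ≡⟨ xy∙z≈xz∙y d e f ⟩
  (d + f) + e ∎
  where open ≤-Reasoning

-- B_{J+1}(m + 1) − B_J(m) ≥ B_3(m + 1) − B_2(m) for J = 2 + t, with both sides moved
-- so that no subtraction occurs.
no-ones-increment-mono : ∀ t m →
  bounded 1 m (2 + t) + bounded 1 (suc m) 3 ≤ bounded 1 (suc m) (3 + t) + bounded 1 m 2
no-ones-increment-mono zero    m = ≤-reflexive (+-comm (bounded 1 m 2) _)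
no-ones-increment-mono (suc t) m with m <? 3 + t
... | yes m<3+t = begin
  bounded 1 m (3 + t) + b₃
    ≡⟨ cong (_+ b₃) (bounded-suc-stable 1 m (2 + t) (≤-pred m<3+t)) ⟩
  bounded 1 m (2 + t) + b₃
    ≤⟨ no-ones-increment-mono t m ⟩
  bounded 1 (suc m) (3 + t) + b₂
    ≡⟨ cong (_+ b₂) (bounded-suc-stable 1 (suc m) (3 + t) m<3+t) ⟨
  bounded 1 (suc m) (4 + t) + b₂ ∎
  where
  open ≤-Reasoning
  b₂ b₃ : ℕ
  b₂ = bounded 1 m 2
  b₃ = bounded 1 (suc m) 3
... | no m≮3+t with m≤n⇒∃[o]m+o≡n (≮⇒≥ m≮3+t)
...   | r , refl = begin
  bounded 1 m (3 + t) + b₃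
    ≡⟨ cong (_+ b₃) (bounded-recurrence 1 r (2 + t) (λ ())) ⟩
  (bounded 1 m (2 + t) + bounded 1 r (3 + t)) + b₃
    ≤⟨ rearrange-≤ (bounded 1 m (2 + t)) (bounded 1 r (3 + t)) b₃
                   (bounded 1 (suc m) (3 + t)) b₂ (bounded 1 r (4 + t))
                   (no-ones-increment-mono t m) (bounded-mono-parts 1 r (3 + t)) ⟩
  (bounded 1 (suc m) (3 + t) + bounded 1 r (4 + t)) + b₂
    ≡⟨ cong (_+ b₂) (bounded-recurrence 1 r (3 + t) (λ ())) ⟨
  bounded 1 (suc m) (4 + t) + b₂ ∎
  where
  open ≤-Reasoning
  b₂ b₃ : ℕ
  b₂ = bounded 1 m 2
  b₃ = bounded 1 (suc m) 3

twos-period : ∀ m → bounded 1 (2 + m) 2 ≡ bounded 1 m 2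
twos-period m = bounded-recurrence 1 m 1 (λ ())

twos-parity : ∀ m → bounded 1 m 2 + bounded 1 (suc m) 2 ≡ 1
twos-parity zero    = refl
twos-parity (suc m) = begin
  bounded 1 (suc m) 2 + bounded 1 (2 + m) 2 ≡⟨ cong (bounded 1 (suc m) 2 +_) (twos-period m) ⟩
  bounded 1 (suc m) 2 + bounded 1 m 2       ≡⟨ +-comm (bounded 1 (suc m) 2) _ ⟩
  bounded 1 m 2 + bounded 1 (suc m) 2       ≡⟨ twos-parity m ⟩
  1 ∎
  where open ≡-Reasoning

twos-threes-recurrence : ∀ m → bounded 1 (3 + m) 3 ≡ bounded 1 (3 + m) 2 + bounded 1 m 3
twos-threes-recurrence m = bounded-recurrence 1 m 2 (λ ())

twos-threes-positive : ∀ m → 1 ≤ bounded 1 (3 + m) 3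
twos-threes-positive m = begin
  1                                     ≡⟨ twos-parity m ⟨
  bounded 1 m 2 + bounded 1 (suc m) 2   ≡⟨ +-comm (bounded 1 m 2) _ ⟩
  bounded 1 (suc m) 2 + bounded 1 m 2   ≡⟨ cong (_+ bounded 1 m 2) (twos-period (suc m)) ⟨
  bounded 1 (3 + m) 2 + bounded 1 m 2   ≤⟨ +-monoʳ-≤ _ (bounded-mono-parts 1 m 2) ⟩
  bounded 1 (3 + m) 2 + bounded 1 m 3   ≡⟨ twos-threes-recurrence m ⟨
  bounded 1 (3 + m) 3 ∎
  where open ≤-Reasoning

twos<twos-threes : ∀ w → bounded 1 (8 + w) 2 < bounded 1 (9 + w) 3
twos<twos-threes w = begin-strict
  bounded 1 (8 + w) 2                         ≡⟨ twos-period (6 + w) ⟩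
  bounded 1 (6 + w) 2                         <⟨ m<m+n _ (twos-threes-positive w) ⟩
  bounded 1 (6 + w) 2 + bounded 1 (3 + w) 3   ≡⟨ twos-threes-recurrence (3 + w) ⟨
  bounded 1 (6 + w) 3                         ≤⟨ m≤n+m _ (bounded 1 (9 + w) 2) ⟩
  bounded 1 (9 + w) 2 + bounded 1 (6 + w) 3   ≡⟨ twos-threes-recurrence (6 + w) ⟨
  bounded 1 (9 + w) 3 ∎
  where open ≤-Reasoning

ν₁-increasing : ∀ m → 8 ≤ m → ν 1 m < ν 1 (suc m)
ν₁-increasing m 8≤m with m≤n⇒∃[o]m+o≡n 8≤m
... | w , refl = +-cancelʳ-< (bounded 1 (8 + w) 2) (ν 1 (8 + w)) (ν 1 (9 + w)) (begin-strict
  ν 1 (8 + w) + bounded 1 (8 + w) 2  <⟨ +-monoʳ-< (ν 1 (8 + w)) (twos<twos-threes w) ⟩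
  ν 1 (8 + w) + bounded 1 (9 + w) 3  ≤⟨ no-ones-increment-mono (6 + w) (8 + w) ⟩
  ν 1 (9 + w) + bounded 1 (8 + w) 2  ∎)
  where open ≤-Reasoning

theorem1p5 : (n k : ℕ) → 2 ≤ n → 1 ≤ k → 384 * (k * k) + 1 ≤ 24 * n →
    ν k (n ∸ k) < ν k n
theorem1p5 (suc m) 1 _ _ bound = ν₁-increasing m (≤-pred 9≤1+m)
  where
  9≤1+m : 9 ≤ suc m
  9≤1+m = *-cancelˡ-≤ 24 (≤-trans (m≤m+n 216 169) bound)
theorem1p5 n k@(suc (suc _)) _ _ bound = ν-drop-part k n (s≤s (s≤s z≤n)) k<n
  where
  k<n : k < n
  k<n = *-cancelˡ-< 24 k n (begin-strict
    24 * k              ≤⟨ *-mono-≤ (m≤m+n 24 360) (m≤m*n k k) ⟩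
    384 * (k * k)       <⟨ m<m+n (384 * (k * k)) (s≤s z≤n) ⟩
    384 * (k * k) + 1   ≤⟨ bound ⟩
    24 * n              ∎)
    where open ≤-Reasoning
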